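{- Consider a Constrained Connectivity instance on a graph with vertex set $V$ whose safe sets are symmetric and hierarchical. Let $H$ be a subgraph that contains a safe path for every hard pair. Then $H$ also contains a safe path for every easy pair, i.e., $H$ is safely connected.
   Context: Constrained Connectivity: given a graph $G=(V,E)$ and for each pair $(u,v)\in V\times V$ a safe set $S(u,v)\subseteq V$ with $u,v\in S(u,v)$. A safe path for $(u,v)$ is a $u$–$v$ path all of whose vertices lie in $S(u,v)$; a subgraph is safely connected if it has a safe path for every pair. The safe sets are symmetric if $S(x,y)=S(y,x)$ for all $x,y$, and hierarchical if for all $x,y,z$, $z\in S(x,y)$ implies $S(x,z)\subseteq S(x,y)$ and $S(z,y)\subseteq S(x,y)$. A pair $\{x,y\}$ is easy if there is some $z\in S(x,y)$ with $S(x,z)\subsetneq S(x,y)$ and $S(y,z)\subsetneq S(x,y)$; otherwise it is hard. -}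

module Defs where

open import Data.Nat using (ℕ)
open import Data.Fin using (Fin)
open import Data.Fin.Subset using (Subset; _∈_; _⊆_; _⊂_)
open import Data.List using (List; []; _∷_)
open import Data.List.Relation.Unary.All using (All)
open import Data.List.Relation.Unary.Unique.Propositional using (Unique)
open import Data.Product using (Σ; ∃; _×_)
open import Relation.Binary.PropositionalEquality using (_≡_)
open import Relation.Nullary using (¬_)

record Graph (n : ℕ) : Set₁ where
  field
    Adj    : Fin n → Fin n → Set
    sym    : ∀ {x y} → Adj x y → Adj y x
    irrefl : ∀ {x} → ¬ Adj x x
open Graph public

_IsSubgraphOf_ : ∀ {n} → Graph n → Graph n → Set
H IsSubgraphOf G = ∀ {x y} → Adj H x y → Adj G x y

data Walk {n : ℕ} (G : Graph n) : Fin n → Fin n → List (Fin n) → Set where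
  here : ∀ {u} → Walk G u u (u ∷ [])
  step : ∀ {u w v vs} → Adj G u w → Walk G w v vs → Walk G u v (u ∷ vs)

IsPath : ∀ {n} → Graph n → Fin n → Fin n → List (Fin n) → Set
IsPath G u v vs = Walk G u v vs × Unique vs

SafeSets : ℕ → Set
SafeSets n = Fin n → Fin n → Subset n

WellFormed : ∀ {n} → SafeSets n → Set
WellFormed S = ∀ x y → x ∈ S x y × y ∈ S x y

Symmetric : ∀ {n} → SafeSets n → Set
Symmetric S = ∀ x y → S x y ≡ S y x

Hierarchical : ∀ {n} → SafeSets n → Set
Hierarchical S = ∀ x y z → z ∈ S x y → (S x z ⊆ S x y) × (S z y ⊆ S x y)

HasSafePath : ∀ {n} → Graph n → SafeSets n → Fin n → Fin n → Set
HasSafePath {n} G S u v =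
  Σ (List (Fin n)) λ vs → IsPath G u v vs × All (λ w → w ∈ S u v) vs

Easy : ∀ {n} → SafeSets n → Fin n → Fin n → Set
Easy S x y = ∃ λ z → z ∈ S x y × (S x z ⊂ S x y) × (S y z ⊂ S x y)

Hard : ∀ {n} → SafeSets n → Fin n → Fin n → Set
Hard S x y = ¬ Easy S x y

SafelyConnected : ∀ {n} → Graph n → SafeSets n → Set
SafelyConnected G S = ∀ x y → HasSafePath G S x y

module Submission where

-- Proof idea: strong induction on the size ∣ S(x,y) ∣ of the safe set.  If
-- {x,y} is hard, the hypothesis applies.  If it is easy, a witness z lies in
-- S(x,y) and has S(x,z), S(z,y) strictly smaller than S(x,y) (using symmetry
-- for S(z,y) = S(y,z)), so by induction there are safe paths x ⇝ z and z ⇝ y.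
-- Hierarchy puts both safe sets inside S(x,y); concatenating gives an x–y walk
-- inside S(x,y), and shortcutting repeated vertices turns it into a path.

open import Data.Nat using (ℕ; _<_)
open import Data.Nat.Induction using (<-wellFounded)
open import Data.Fin using (Fin)
open import Data.Fin.Properties using (any?) renaming (_≟_ to _≟F_)
open import Data.Fin.Subset using (Subset; ∣_∣; _⊆_; _⊂_) renaming (_∈_ to _∈ₛ_)
open import Data.Fin.Subset.Properties using (_∈?_; _⊂?_; p⊂q⇒∣p∣<∣q∣)
open import Data.List using (List)
open import Data.List.Relation.Unary.All as All using (All; []; _∷_)
open import Data.List.Relation.Unary.All.Properties using (¬Any⇒All¬)
open import Data.List.Relation.Unary.Any using (here; there)
open import Data.List.Relation.Unary.AllPairs using ([]; _∷_)
open import Data.List.Membership.Propositional using (_∈_)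
open import Data.List.Relation.Unary.Unique.Propositional using (Unique)
open import Data.Product using (Σ; _×_; _,_; uncurry)
open import Induction.WellFounded using (WellFounded; module All)
open import Relation.Binary.Construct.On as On using ()
open import Relation.Binary.PropositionalEquality using (refl; subst)
open import Relation.Nullary using (Dec; yes; no)
open import Relation.Nullary.Decidable using (_×-dec_)
open import Defs

module ConstrainedWalks {n : ℕ} (G : Graph n) (P : Fin n → Set) where
  open import Data.List.Membership.DecPropositional (_≟F_ {n}) using ()
    renaming (_∈?_ to _∈?ₗ_)

  PWalk : Fin n → Fin n → Set
  PWalk u v = Σ (List (Fin n)) λ vs → Walk G u v vs × All P vs

  PPath : Fin n → Fin n → Set
  PPath u v = Σ (List (Fin n)) λ vs → IsPath G u v vs × All P vs

  walk-++ : ∀ {u w v} → PWalk u w → PWalk w v → PWalk u v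
  walk-++ (_ , here , _) q = q
  walk-++ (_ , step a wk , p ∷ ps) q with walk-++ (_ , wk , ps) q
  ... | (_ , wk′ , ps′) = _ , step a wk′ , p ∷ ps′

  path-suffix : ∀ {u w v vs} → Walk G w v vs → Unique vs → All P vs → u ∈ vs
              → PPath u v
  path-suffix here        uq       ps       (here refl) = _ , (here , uq) , ps
  path-suffix (step a wk) uq       ps       (here refl) = _ , (step a wk , uq) , ps
  path-suffix (step _ wk) (_ ∷ uq) (_ ∷ ps) (there u∈)  = path-suffix wk uq ps u∈

  -- If the first vertex recurs on the shortened tail, jump
  -- to its occurrence there; otherwise it can be prepended without repetition.
  walk⇒path : ∀ {u v} → PWalk u v → PPath u v
  walk⇒path (_ , here , ps) = _ , (here , [] ∷ []) , ps
  walk⇒path {u} (_ , step a wk , p ∷ ps) with walk⇒path (_ , wk , ps)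
  ... | (tail , (wk′ , uq) , ps′) with u ∈?ₗ tail
  ...   | yes u∈ = path-suffix wk′ uq ps′ u∈
  ...   | no  u∉ = _ , (step a wk′ , ¬Any⇒All¬ tail u∉ ∷ uq) , p ∷ ps′

open ConstrainedWalks using (PWalk; walk-++; walk⇒path)

module _ {n : ℕ} (S : SafeSets n) where

  -- Easiness is decidable, since every ingredient ranges over finite sets.
  easy? : ∀ x y → Dec (Easy S x y)
  easy? x y = any? λ z → (z ∈? S x y) ×-dec ((S x z ⊂? S x y) ×-dec (S y z ⊂? S x y))

  easy-shrinks : Symmetric S → ∀ {x y z} → S x z ⊂ S x y → S y z ⊂ S x y
               → ∣ S x z ∣ < ∣ S x y ∣ × ∣ S z y ∣ < ∣ S x y ∣
  easy-shrinks sym {x} {y} {z} xz⊂ yz⊂ =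
    p⊂q⇒∣p∣<∣q∣ xz⊂ , p⊂q⇒∣p∣<∣q∣ (subst (_⊂ S x y) (sym y z) yz⊂)

  widen : ∀ {H : Graph n} {u v} {T : Subset n} → S u v ⊆ T
        → HasSafePath H S u v → PWalk H (_∈ₛ T) u v
  widen incl (_ , (wk , _) , safe) = _ , wk , All.map incl safe

  join-safe : Hierarchical S → ∀ {H : Graph n} {x y z} → z ∈ₛ S x y
            → HasSafePath H S x z → HasSafePath H S z y → HasSafePath H S x y
  join-safe hier {H} {x} {y} {z} z∈ xz zy with hier x y z z∈
  ... | (xz⊆ , zy⊆) = walk⇒path H (_∈ₛ S x y) (walk-++ H _ (widen xz⊆ xz) (widen zy⊆ zy))

  safe-size : Fin n × Fin n → ℕ
  safe-size (x , y) = ∣ S x y ∣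

  _≺_ : Fin n × Fin n → Fin n × Fin n → Set
  p ≺ q = safe-size p < safe-size q

  ≺-wellFounded : WellFounded _≺_
  ≺-wellFounded = On.wellFounded safe-size <-wellFounded

lemma23 : (n : ℕ) (G H : Graph n) (S : SafeSets n)
    → WellFormed S → Symmetric S → Hierarchical S
    → H IsSubgraphOf G
    → (∀ x y → Hard S x y → HasSafePath H S x y)
    → SafelyConnected H S
lemma23 n G H S _ sym hier _ hard x y =
  All.wfRec (≺-wellFounded S) _ (uncurry (HasSafePath H S)) by-easiness (x , y)
  where
  by-easiness : ∀ p → (∀ {q} → _≺_ S q p → uncurry (HasSafePath H S) q)
              → uncurry (HasSafePath H S) p
  by-easiness (x , y) ih with easy? S x y
  ... | no  ¬easy = hard x y ¬easy
  ... | yes (z , z∈ , xz⊂ , yz⊂) with easy-shrinks S sym xz⊂ yz⊂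
  ...   | (xz< , zy<) = join-safe S hier z∈ (ih xz<) (ih zy<)
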